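{- For positive integers $m,n$, \[ \sum_{a=1}^{m}\sum_{b=1}^{n}\binom{m+n-a-b}{m-a}\frac{(m+n)^{a+b-2}}{m^{a-1}n^{b-1}} =\frac{(m+n)^{m+n-1}}{m^{m-1}n^{n-1}}-\frac{mn}{m+n}\binom{m+n}{m}. \]
   Context: Binomial coefficients with negative lower index are $0$. -}

module Defs where

open import Data.Nat as ℕ using (ℕ; zero; suc; _^_; NonZero; _∸_)
open import Data.Nat.Properties using (m^n≢0; m*n≢0)
open import Data.Nat.Combinatorics using (_C_)
open import Data.Integer using (+_)
open import Data.Rational as ℚ using (ℚ; _/_; 0ℚ)

sumFrom1 : ℕ → (ℕ → ℚ) → ℚ
sumFrom1 zero    f = 0ℚ
sumFrom1 (suc n) f = sumFrom1 n f ℚ.+ f (suc n)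

-- summand  C(m+n-a-b, m-a) * (m+n)^(a+b-2) / (m^(a-1) n^(b-1))
-- (only used for 1 ≤ a ≤ m, 1 ≤ b ≤ n, where all ∸ are genuine subtraction)
term : (m n : ℕ) → .{{NonZero m}} → .{{NonZero n}} → ℕ → ℕ → ℚ
term m n a b =
  _/_ (+ ((((m ℕ.+ n) ∸ (a ℕ.+ b)) C (m ∸ a)) ℕ.* (m ℕ.+ n) ^ ((a ℕ.+ b) ∸ 2)))
    (m ^ (a ∸ 1) ℕ.* n ^ (b ∸ 1))
    {{m*n≢0 (m ^ (a ∸ 1)) (n ^ (b ∸ 1)) {{m^n≢0 m (a ∸ 1)}} {{m^n≢0 n (b ∸ 1)}}}}

lhs : (m n : ℕ) → .{{NonZero m}} → .{{NonZero n}} → ℚ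
lhs m n = sumFrom1 m (λ a → sumFrom1 n (λ b → term m n a b))

rhs : (m n : ℕ) → .{{NonZero m}} → .{{NonZero n}} → ℚ
rhs m n =
  (_/_ (+ ((m ℕ.+ n) ^ ((m ℕ.+ n) ∸ 1)))
     (m ^ (m ∸ 1) ℕ.* n ^ (n ∸ 1))
     {{m*n≢0 (m ^ (m ∸ 1)) (n ^ (n ∸ 1)) {{m^n≢0 m (m ∸ 1)}} {{m^n≢0 n (n ∸ 1)}}}})
  ℚ.- (_/_ (+ (m ℕ.* n)) (m ℕ.+ n) {{plusNZ m n}}) ℚ.* (+ ((m ℕ.+ n) C m) / 1)
  where
  plusNZ : (m n : ℕ) → .{{NonZero m}} → NonZero (m ℕ.+ n)
  plusNZ (suc m) n = _

{-# OPTIONS --safe #-}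
module Submission where

-- Write m = k + 1, n = l + 1, s = x + y and w i j = C(i+j, i) x^i y^j. Clearing the
-- denominator m^(m-1) n^(n-1) and putting i = m - a, j = n - b, the double sum becomes
-- R = Σ_{i<m, j<n} w i j s^((m-1-i)+(n-1-j)) evaluated at x = m, y = n, and since
-- mn/(m+n) C(m+n, m) = n C(m+n-1, m-1) the claim is R + n C(m+n-1, m-1) m^(m-1) n^(n-1) = s^(m+n-1).
-- Expanding s^(m+n-1) over words in x and y, and splitting by whether a word first
-- contains m letters x or n letters y, gives
--   s^(m+n-1) = x Σ_{j<n} w (m-1) j s^(n-1-j) + y Σ_{i<m} w i (n-1) s^(m-1-i).
-- The absorption identity (i+1) C(i+1+j, i+1) = (i+j+1) C(i+j, i) gives, for all x and y,
--   R = m Σ_{j<n} w (m-1) j s^(n-1-j) + n Σ_{i<m-1} w i n s^(m-2-i),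
-- and the last sum differs from Σ_{i<m} w i (n-1) s^(m-1-i) by the single term
-- C(m+n-1, m-1) x^(m-1) y^(n-1). At x = m, y = n the two expansions combine to the claim.

open import Algebra.Properties.Group using (//-rightDividesʳ)
open import Data.Integer as ℤ using (+_)
import Data.Integer.Properties as ℤ
open import Data.Nat using (ℕ; zero; suc; _+_; _*_; _^_; _∸_; _≤_; _<_; s≤s; NonZero)
open import Data.Nat.Combinatorics using (_C_; nCn≡1; nCk+nC[k+1]≡[n+1]C[k+1])
open import Data.Nat.Properties
open import Data.Nat.Tactic.RingSolver using (solve-∀)
open import Data.Product using (_,_)
open import Data.Rational as ℚ using (ℚ; _/_)
open import Data.Rational.Properties
  using (fromℚᵘ-cong; toℚᵘ-injective; toℚᵘ-fromℚᵘ; toℚᵘ-homo-+; toℚᵘ-homo-*; +-0-group)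
import Data.Rational.Unnormalised as ℚᵘ
import Data.Rational.Unnormalised.Properties as ℚᵘ
open import Relation.Binary.PropositionalEquality

open import Defs

infixl 7 _÷_

_÷_ : ℕ → (d : ℕ) → .{{NonZero d}} → ℚ
x ÷ d = (+ x) / d

÷-≡ : ∀ x y d e .{{_ : NonZero d}} .{{_ : NonZero e}} → x * e ≡ y * d → x ÷ d ≡ y ÷ e
÷-≡ x y (suc d) (suc e) eq = fromℚᵘ-cong {ℚᵘ.mkℚᵘ (+ x) d} {ℚᵘ.mkℚᵘ (+ y) e} (ℚᵘ.*≡* (begin
  + x ℤ.* + suc e ≡⟨ ℤ.pos-* x (suc e) ⟨
  + (x * suc e)   ≡⟨ cong +_ eq ⟩
  + (y * suc d)   ≡⟨ ℤ.pos-* y (suc d) ⟩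
  + y ℤ.* + suc d ∎))
  where open ≡-Reasoning

toℚᵘ-÷ : ∀ x d → ℚ.toℚᵘ (x ÷ suc d) ℚᵘ.≃ ℚᵘ.mkℚᵘ (+ x) d
toℚᵘ-÷ x d = toℚᵘ-fromℚᵘ (ℚᵘ.mkℚᵘ (+ x) d)

÷-+-÷ : ∀ x y d e .{{_ : NonZero d}} .{{_ : NonZero e}} →
        x ÷ d ℚ.+ y ÷ e ≡ ((x * e + y * d) ÷ (d * e)) {{m*n≢0 d e}}
÷-+-÷ x y (suc d) (suc e) = toℚᵘ-injective (begin
  ℚ.toℚᵘ (x ÷ suc d ℚ.+ y ÷ suc e)             ≈⟨ toℚᵘ-homo-+ (x ÷ suc d) (y ÷ suc e) ⟩
  ℚ.toℚᵘ (x ÷ suc d) ℚᵘ.+ ℚ.toℚᵘ (y ÷ suc e)   ≈⟨ ℚᵘ.+-cong (toℚᵘ-÷ x d) (toℚᵘ-÷ y e) ⟩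
  ℚᵘ.mkℚᵘ (+ x) d ℚᵘ.+ ℚᵘ.mkℚᵘ (+ y) e          ≡⟨ cong (λ i → ℚᵘ.mkℚᵘ i _) numerator ⟩
  ℚᵘ.mkℚᵘ (+ (x * suc e + y * suc d)) _         ≈⟨ toℚᵘ-÷ (x * suc e + y * suc d) _ ⟨
  ℚ.toℚᵘ ((x * suc e + y * suc d) ÷ (suc d * suc e)) ∎)
  where
  open ℚᵘ.≃-Reasoning
  numerator : + x ℤ.* + suc e ℤ.+ + y ℤ.* + suc d ≡ + (x * suc e + y * suc d)
  numerator = trans (sym (cong₂ ℤ._+_ (ℤ.pos-* x (suc e)) (ℤ.pos-* y (suc d))))
                    (sym (ℤ.pos-+ (x * suc e) (y * suc d)))

÷-*-÷ : ∀ x y d e .{{_ : NonZero d}} .{{_ : NonZero e}} →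
        (x ÷ d) ℚ.* (y ÷ e) ≡ ((x * y) ÷ (d * e)) {{m*n≢0 d e}}
÷-*-÷ x y (suc d) (suc e) = toℚᵘ-injective (begin
  ℚ.toℚᵘ ((x ÷ suc d) ℚ.* (y ÷ suc e))         ≈⟨ toℚᵘ-homo-* (x ÷ suc d) (y ÷ suc e) ⟩
  ℚ.toℚᵘ (x ÷ suc d) ℚᵘ.* ℚ.toℚᵘ (y ÷ suc e)   ≈⟨ ℚᵘ.*-cong (toℚᵘ-÷ x d) (toℚᵘ-÷ y e) ⟩
  ℚᵘ.mkℚᵘ (+ x) d ℚᵘ.* ℚᵘ.mkℚᵘ (+ y) e          ≡⟨ cong (λ i → ℚᵘ.mkℚᵘ i _) (ℤ.pos-* x y) ⟨
  ℚᵘ.mkℚᵘ (+ (x * y)) _                         ≈⟨ toℚᵘ-÷ (x * y) _ ⟨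
  ℚ.toℚᵘ ((x * y) ÷ (suc d * suc e))           ∎)
  where open ℚᵘ.≃-Reasoning

open ≡-Reasoning

sumFrom1ℕ : ℕ → (ℕ → ℕ) → ℕ
sumFrom1ℕ zero    f = 0
sumFrom1ℕ (suc n) f = sumFrom1ℕ n f + f (suc n)

sumFrom1ℕ-front : ∀ n f → sumFrom1ℕ (suc n) f ≡ f 1 + sumFrom1ℕ n (λ a → f (suc a))
sumFrom1ℕ-front zero    f = +-comm 0 (f 1)
sumFrom1ℕ-front (suc n) f = begin
  sumFrom1ℕ (suc n) f + f (suc (suc n))
    ≡⟨ cong (_+ f (suc (suc n))) (sumFrom1ℕ-front n f) ⟩
  f 1 + sumFrom1ℕ n (λ a → f (suc a)) + f (suc (suc n))
    ≡⟨ +-assoc (f 1) _ _ ⟩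
  f 1 + (sumFrom1ℕ n (λ a → f (suc a)) + f (suc (suc n))) ∎

sumFrom1ℕ-cong : ∀ n {f g} → (∀ a → f (suc a) ≡ g (suc a)) → sumFrom1ℕ n f ≡ sumFrom1ℕ n g
sumFrom1ℕ-cong zero    eq = refl
sumFrom1ℕ-cong (suc n) eq = cong₂ _+_ (sumFrom1ℕ-cong n eq) (eq n)

*-distribˡ-sumFrom1ℕ : ∀ n c f → c * sumFrom1ℕ n f ≡ sumFrom1ℕ n (λ a → c * f a)
*-distribˡ-sumFrom1ℕ zero    c f = *-zeroʳ c
*-distribˡ-sumFrom1ℕ (suc n) c f = trans (*-distribˡ-+ c (sumFrom1ℕ n f) (f (suc n)))
                                         (cong (_+ c * f (suc n)) (*-distribˡ-sumFrom1ℕ n c f))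

pascal : ℕ → ℕ → ℕ
pascal zero    j       = 1
pascal (suc i) zero    = 1
pascal (suc i) (suc j) = pascal i (suc j) + pascal (suc i) j

pascal-0ʳ : ∀ i → pascal i 0 ≡ 1
pascal-0ʳ zero    = refl
pascal-0ʳ (suc i) = refl

pascal≡C : ∀ i j → pascal i j ≡ (i + j) C i
pascal≡C zero    j       = refl
pascal≡C (suc i) zero    = sym (trans (cong (_C suc i) (+-identityʳ (suc i))) (nCn≡1 (suc i)))
pascal≡C (suc i) (suc j) = begin
  pascal i (suc j) + pascal (suc i) j        ≡⟨ cong₂ _+_ (pascal≡C i (suc j)) (pascal≡C (suc i) j) ⟩
  (i + suc j) C i + (suc i + j) C suc i      ≡⟨ cong (λ t → (i + suc j) C i + t C suc i) (+-suc i j) ⟨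
  (i + suc j) C i + (i + suc j) C suc i      ≡⟨ nCk+nC[k+1]≡[n+1]C[k+1] (i + suc j) i ⟩
  suc (i + suc j) C suc i                    ∎

pascal-absorbˡ : ∀ i j → suc i * pascal (suc i) j ≡ suc (i + j) * pascal i j
pascal-absorbʳ : ∀ i j → suc j * pascal i (suc j) ≡ suc (i + j) * pascal i j

pascal-absorbˡ i zero    rewrite pascal-0ʳ i | +-identityʳ i = refl
pascal-absorbˡ i (suc j) = begin
  suc i * (P₁ + P₂)                    ≡⟨ *-distribˡ-+ (suc i) P₁ P₂ ⟩
  suc i * P₁ + suc i * P₂              ≡⟨ cong (λ t → suc i * P₁ + t) (trans (pascal-absorbˡ i j)
                                                                        (sym (pascal-absorbʳ i j))) ⟩
  suc i * P₁ + suc j * P₁              ≡⟨ *-distribʳ-+ P₁ (suc i) (suc j) ⟨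
  suc (i + suc j) * P₁                 ∎
  where P₁ = pascal i (suc j); P₂ = pascal (suc i) j

pascal-absorbʳ zero    j = refl
pascal-absorbʳ (suc i) j = begin
  suc j * (P₁ + P₂)                    ≡⟨ *-distribˡ-+ (suc j) P₁ P₂ ⟩
  suc j * P₁ + suc j * P₂              ≡⟨ cong (_+ suc j * P₂) (trans (pascal-absorbʳ i j)
                                                                 (sym (pascal-absorbˡ i j))) ⟩
  suc i * P₂ + suc j * P₂              ≡⟨ *-distribʳ-+ P₂ (suc i) (suc j) ⟨
  suc (i + suc j) * P₂                 ≡⟨ cong (λ t → suc t * P₂) (+-suc i j) ⟩
  suc (suc i + j) * P₂                 ∎
  where P₁ = pascal i (suc j); P₂ = pascal (suc i) j

horner : ℕ → (ℕ → ℕ) → ℕ → ℕ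
horner s g zero    = 0
horner s g (suc a) = s * horner s g a + g a

horner≡sumFrom1ℕ : ∀ s g a → horner s g a ≡ sumFrom1ℕ a (λ i → s ^ (i ∸ 1) * g (a ∸ i))
horner≡sumFrom1ℕ s g zero    = refl
horner≡sumFrom1ℕ s g (suc a) = begin
  s * horner s g a + g a
    ≡⟨ cong (λ h → s * h + g a) (horner≡sumFrom1ℕ s g a) ⟩
  s * sumFrom1ℕ a (λ i → s ^ (i ∸ 1) * g (a ∸ i)) + g a
    ≡⟨ cong (_+ g a) (*-distribˡ-sumFrom1ℕ a s _) ⟩
  sumFrom1ℕ a (λ i → s * (s ^ (i ∸ 1) * g (a ∸ i))) + g a
    ≡⟨ cong (_+ g a) (sumFrom1ℕ-cong a (λ i → *-assoc s (s ^ i) (g (a ∸ suc i)))) ⟨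
  S + g a
    ≡⟨ +-comm S (g a) ⟩
  g a + S
    ≡⟨ cong (_+ S) (*-identityˡ (g a)) ⟨
  1 * g a + S
    ≡⟨ sumFrom1ℕ-front a _ ⟨
  sumFrom1ℕ (suc a) (λ i → s ^ (i ∸ 1) * g (suc a ∸ i)) ∎
  where S = sumFrom1ℕ a (λ i → s ^ i * g (a ∸ i))

-- col k b = Σ_{j<b} w k j s^(b-1-j),  row l a = Σ_{i<a} w i l s^(a-1-i),  rect a b = Σ_{i<a} col i b s^(a-1-i)
module Lattice (x y : ℕ) where

  s : ℕ
  s = x + y

  w : ℕ → ℕ → ℕ
  w i j = pascal i j * (x ^ i * y ^ j)

  col : ℕ → ℕ → ℕ
  col k = horner s (w k)

  row : ℕ → ℕ → ℕ
  row l = horner s (λ i → w i l)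

  rect : ℕ → ℕ → ℕ
  rect a b = horner s (λ i → col i b) a

  w-0ʳ : ∀ k → w k 0 ≡ x ^ k
  w-0ʳ k rewrite pascal-0ʳ k = trans (+-identityʳ _) (*-identityʳ (x ^ k))

  w-0ˡ : ∀ l → w 0 l ≡ y ^ l
  w-0ˡ l = trans (+-identityʳ _) (+-identityʳ (y ^ l))

  w-pascal : ∀ k l → w (suc k) (suc l) ≡ x * w k (suc l) + y * w (suc k) l
  w-pascal k l = rearrange x y (pascal k (suc l)) (pascal (suc k) l) (x ^ k) (y ^ l)
    where
    rearrange : ∀ x y P₁ P₂ X Y →
      (P₁ + P₂) * (x * X * (y * Y))
      ≡ x * (P₁ * (X * (y * Y))) + y * (P₂ * (x * X * Y))
    rearrange = solve-∀

  col-pascal : ∀ k l → col (suc k) (suc l) ≡ x * col k (suc l) + y * col (suc k) l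
  col-pascal k zero    rewrite w-0ʳ k = rearrange x y (x ^ k)
    where
    rearrange : ∀ x y X → (x + y) * 0 + 1 * (x * X * 1) ≡ x * ((x + y) * 0 + X) + y * 0
    rearrange = solve-∀
  col-pascal k (suc l) = begin
    s * col (suc k) (suc l) + w (suc k) (suc l)
      ≡⟨ cong₂ (λ c v → s * c + v) (col-pascal k l) (w-pascal k l) ⟩
    s * (x * col k (suc l) + y * col (suc k) l) + (x * w k (suc l) + y * w (suc k) l)
      ≡⟨ rearrange x y (col k (suc l)) (col (suc k) l) (w k (suc l)) (w (suc k) l) ⟩
    x * (s * col k (suc l) + w k (suc l)) + y * (s * col (suc k) l + w (suc k) l) ∎
    where
    rearrange : ∀ x y a b c d →
      (x + y) * (x * a + y * b) + (x * c + y * d)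
      ≡ x * ((x + y) * a + c) + y * ((x + y) * b + d)
    rearrange = solve-∀

  row-pascal : ∀ l k → row (suc l) (suc k) ≡ y * row l (suc k) + x * row (suc l) k
  row-pascal l zero    rewrite w-0ˡ l = rearrange x y (y ^ l)
    where
    rearrange : ∀ x y Y → (x + y) * 0 + 1 * (1 * (y * Y)) ≡ y * ((x + y) * 0 + Y) + x * 0
    rearrange = solve-∀
  row-pascal l (suc k) = begin
    s * row (suc l) (suc k) + w (suc k) (suc l)
      ≡⟨ cong₂ (λ r v → s * r + v) (row-pascal l k) (w-pascal k l) ⟩
    s * (y * row l (suc k) + x * row (suc l) k) + (x * w k (suc l) + y * w (suc k) l)
      ≡⟨ rearrange x y (row l (suc k)) (row (suc l) k) (w k (suc l)) (w (suc k) l) ⟩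
    y * (s * row l (suc k) + w (suc k) l) + x * (s * row (suc l) k + w k (suc l)) ∎
    where
    rearrange : ∀ x y a b c d →
      (x + y) * (y * a + x * b) + (x * c + y * d)
      ≡ y * ((x + y) * a + d) + x * ((x + y) * b + c)
    rearrange = solve-∀

  first-exit-decomposition : ∀ k l → x * col k (suc l) + y * row l (suc k) ≡ s ^ suc (k + l)
  first-exit-decomposition zero zero = rearrange x y
    where
    rearrange : ∀ x y → x * ((x + y) * 0 + 1 * (1 * 1)) + y * ((x + y) * 0 + 1 * (1 * 1)) ≡ (x + y) * 1
    rearrange = solve-∀
  first-exit-decomposition zero (suc l) = begin
    x * (s * col 0 (suc l) + w 0 (suc l)) + y * (s * 0 + w 0 (suc l))
      ≡⟨ rearrange x y (col 0 (suc l)) (y ^ l) ⟩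
    s * (x * col 0 (suc l) + y * (s * 0 + w 0 l))
      ≡⟨ cong (s *_) (first-exit-decomposition zero l) ⟩
    s * s ^ suc l ∎
    where
    rearrange : ∀ x y c Y →
      x * ((x + y) * c + 1 * (1 * (y * Y))) + y * ((x + y) * 0 + 1 * (1 * (y * Y)))
      ≡ (x + y) * (x * c + y * ((x + y) * 0 + 1 * (1 * Y)))
    rearrange = solve-∀
  first-exit-decomposition (suc k) zero = begin
    x * (s * 0 + w (suc k) 0) + y * (s * row 0 (suc k) + w (suc k) 0)
      ≡⟨ cong (λ v → x * (s * 0 + v) + y * (s * row 0 (suc k) + v)) (w-0ʳ (suc k)) ⟩
    x * (s * 0 + x * x ^ k) + y * (s * row 0 (suc k) + x * x ^ k)
      ≡⟨ rearrange x y (x ^ k) (row 0 (suc k)) ⟩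
    s * (x * (s * 0 + x ^ k) + y * row 0 (suc k))
      ≡⟨ cong (λ v → s * (x * (s * 0 + v) + y * row 0 (suc k))) (w-0ʳ k) ⟨
    s * (x * (s * 0 + w k 0) + y * row 0 (suc k))
      ≡⟨ cong (s *_) (first-exit-decomposition k zero) ⟩
    s * s ^ suc (k + 0) ∎
    where
    rearrange : ∀ x y X r →
      x * ((x + y) * 0 + x * X) + y * ((x + y) * r + x * X)
      ≡ (x + y) * (x * ((x + y) * 0 + X) + y * r)
    rearrange = solve-∀
  first-exit-decomposition (suc k) (suc l) = begin
    x * col (suc k) (suc (suc l)) + y * row (suc l) (suc (suc k))
      ≡⟨ cong₂ (λ c r → x * c + y * r) (col-pascal k (suc l)) (row-pascal l (suc k)) ⟩
    x * (x * col k (suc (suc l)) + y * col (suc k) (suc l)) + y * (y * row l (suc (suc k)) + x * row (suc l) (suc k))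
      ≡⟨ rearrange x y (col k (suc (suc l))) (col (suc k) (suc l)) (row l (suc (suc k))) (row (suc l) (suc k)) ⟩
    x * (x * col k (suc (suc l)) + y * row (suc l) (suc k)) + y * (x * col (suc k) (suc l) + y * row l (suc (suc k)))
      ≡⟨ cong₂ (λ u v → x * u + y * v) (first-exit-decomposition k (suc l)) (first-exit-decomposition (suc k) l) ⟩
    x * s ^ suc (k + suc l) + y * s ^ suc (suc k + l)
      ≡⟨ cong (λ t → x * s ^ suc (k + suc l) + y * s ^ suc t) (+-suc k l) ⟨
    x * s ^ suc (k + suc l) + y * s ^ suc (k + suc l)
      ≡⟨ *-distribʳ-+ (s ^ suc (k + suc l)) x y ⟨
    s * s ^ suc (k + suc l) ∎
    where
    rearrange : ∀ x y a b c d →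
      x * (x * a + y * b) + y * (y * c + x * d)
      ≡ x * (x * a + y * d) + y * (x * b + y * c)
    rearrange = solve-∀

  row-shift : ∀ l k → row l (suc k) ≡ row (suc l) k + pascal k (suc l) * (x ^ k * y ^ l)
  row-shift l zero = rearrange x y (y ^ l)
    where
    rearrange : ∀ x y Y → (x + y) * 0 + 1 * (1 * Y) ≡ 0 + 1 * (1 * Y)
    rearrange = solve-∀
  row-shift l (suc k) = begin
    s * row l (suc k) + w (suc k) l
      ≡⟨ cong (λ r → s * r + w (suc k) l) (row-shift l k) ⟩
    s * (row (suc l) k + pascal k (suc l) * (x ^ k * y ^ l)) + w (suc k) l
      ≡⟨ rearrange x y (row (suc l) k) (pascal k (suc l)) (pascal (suc k) l) (x ^ k) (y ^ l) ⟩
    (s * row (suc l) k + w k (suc l)) + (pascal k (suc l) + pascal (suc k) l) * (x ^ suc k * y ^ l) ∎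
    where
    rearrange : ∀ x y r P₁ P₂ X Y →
      (x + y) * (r + P₁ * (X * Y)) + P₂ * (x * X * Y)
      ≡ ((x + y) * r + P₁ * (X * (y * Y))) + (P₁ + P₂) * (x * X * Y)
    rearrange = solve-∀

  col-absorb : ∀ k b → s * (suc k * col k b) ≡ suc k * col (suc k) b + b * w k b
  col-absorb k zero = rearrange x y k
    where
    rearrange : ∀ x y k → (x + y) * (suc k * 0) ≡ suc k * 0 + 0
    rearrange = solve-∀
  col-absorb k (suc b) = begin
    s * (suc k * (s * c + W))
      ≡⟨ rearrange₁ x y k c W ⟩
    s * (s * (suc k * c)) + s * suc k * W
      ≡⟨ cong (λ t → s * t + s * suc k * W) (col-absorb k b) ⟩
    s * (suc k * c′ + b * W) + s * suc k * W
      ≡⟨ rearrange₂ x y k b c′ P X Y ⟩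
    s * (suc k * c′) + suc (k + b) * P * (x * X * Y) + suc (k + b) * P * (X * (y * Y))
      ≡⟨ cong₂ (λ u v → s * (suc k * c′) + u * (x * X * Y) + v * (X * (y * Y)))
               (pascal-absorbˡ k b) (pascal-absorbʳ k b) ⟨
    s * (suc k * c′) + suc k * pascal (suc k) b * (x * X * Y) + suc b * pascal k (suc b) * (X * (y * Y))
      ≡⟨ rearrange₃ x y k b c′ (pascal (suc k) b) (pascal k (suc b)) X Y ⟩
    suc k * (s * c′ + w (suc k) b) + suc b * w k (suc b) ∎
    where
    c = col k b
    c′ = col (suc k) b
    W = w k b
    P = pascal k b
    X = x ^ k
    Y = y ^ b
    rearrange₁ : ∀ x y k c W →
      (x + y) * (suc k * ((x + y) * c + W))
      ≡ (x + y) * ((x + y) * (suc k * c)) + (x + y) * suc k * W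
    rearrange₁ = solve-∀
    rearrange₂ : ∀ x y k b c′ P X Y →
      (x + y) * (suc k * c′ + b * (P * (X * Y))) + (x + y) * suc k * (P * (X * Y))
      ≡ (x + y) * (suc k * c′) + suc (k + b) * P * (x * X * Y) + suc (k + b) * P * (X * (y * Y))
    rearrange₂ = solve-∀
    rearrange₃ : ∀ x y k b c′ P₁ P₂ X Y →
      (x + y) * (suc k * c′) + suc k * P₁ * (x * X * Y) + suc b * P₂ * (X * (y * Y))
      ≡ suc k * ((x + y) * c′ + P₁ * (x * X * Y)) + suc b * (P₂ * (X * (y * Y)))
    rearrange₃ = solve-∀

  rect-suc : ∀ k b → rect (suc k) b ≡ suc k * col k b + b * row b k
  rect-suc zero b = rearrange x y (col 0 b) b
    where
    rearrange : ∀ x y c b → (x + y) * 0 + c ≡ 1 * c + b * 0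
    rearrange = solve-∀
  rect-suc (suc k) b = begin
    s * rect (suc k) b + col (suc k) b
      ≡⟨ cong (λ t → s * t + col (suc k) b) (rect-suc k b) ⟩
    s * (suc k * col k b + b * row b k) + col (suc k) b
      ≡⟨ rearrange₁ x y k b (col k b) (row b k) (col (suc k) b) ⟩
    s * (suc k * col k b) + s * b * row b k + col (suc k) b
      ≡⟨ cong (λ t → t + s * b * row b k + col (suc k) b) (col-absorb k b) ⟩
    suc k * col (suc k) b + b * w k b + s * b * row b k + col (suc k) b
      ≡⟨ rearrange₂ x y k b (col (suc k) b) (w k b) (row b k) ⟩
    suc (suc k) * col (suc k) b + b * (s * row b k + w k b) ∎
    where
    rearrange₁ : ∀ x y k b c r c′ →
      (x + y) * (suc k * c + b * r) + c′
      ≡ (x + y) * (suc k * c) + (x + y) * b * r + c′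
    rearrange₁ = solve-∀
    rearrange₂ : ∀ x y k b c′ W r →
      suc k * c′ + b * W + (x + y) * b * r + c′
      ≡ suc (suc k) * c′ + b * ((x + y) * r + W)
    rearrange₂ = solve-∀

  rectTerm : ℕ → ℕ → ℕ → ℕ → ℕ
  rectTerm a b a′ b′ = s ^ (a′ ∸ 1) * (s ^ (b′ ∸ 1) * w (a ∸ a′) (b ∸ b′))

  rect≡sumFrom1ℕ² : ∀ a b → rect a b ≡ sumFrom1ℕ a (λ a′ → sumFrom1ℕ b (rectTerm a b a′))
  rect≡sumFrom1ℕ² a b = trans (horner≡sumFrom1ℕ s (λ i → col i b) a) (sumFrom1ℕ-cong a (λ a′ →
    trans (cong (s ^ a′ *_) (horner≡sumFrom1ℕ s (w (a ∸ suc a′)) b))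
          (*-distribˡ-sumFrom1ℕ b (s ^ a′) _)))

sumFrom1-cong : ∀ n {f g : ℕ → ℚ} → (∀ a → a < n → f (suc a) ≡ g (suc a)) →
                sumFrom1 n f ≡ sumFrom1 n g
sumFrom1-cong zero    eq = refl
sumFrom1-cong (suc n) eq =
  cong₂ ℚ._+_ (sumFrom1-cong n (λ a a<n → eq a (m<n⇒m<1+n a<n))) (eq n (n<1+n n))

sumFrom1-÷ : ∀ n (f : ℕ → ℕ) d .{{_ : NonZero d}} →
             sumFrom1 n (λ a → f a ÷ d) ≡ sumFrom1ℕ n f ÷ d
sumFrom1-÷ zero    f d = ÷-≡ 0 0 1 d refl
sumFrom1-÷ (suc n) f d = begin
  sumFrom1 n (λ a → f a ÷ d) ℚ.+ f (suc n) ÷ d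
    ≡⟨ cong (ℚ._+ f (suc n) ÷ d) (sumFrom1-÷ n f d) ⟩
  S ÷ d ℚ.+ x ÷ d
    ≡⟨ ÷-+-÷ S x d d ⟩
  ((S * d + x * d) ÷ (d * d)) {{m*n≢0 d d}}
    ≡⟨ ÷-≡ (S * d + x * d) (S + x) (d * d) d {{m*n≢0 d d}} (rearrange S x d) ⟩
  (S + x) ÷ d ∎
  where
  S = sumFrom1ℕ n f
  x = f (suc n)
  rearrange : ∀ S x d → (S * d + x * d) * d ≡ (S + x) * (d * d)
  rearrange = solve-∀

x+y≡z⇒x≡z-y : ∀ {x y z} → x ℚ.+ y ≡ z → x ≡ z ℚ.- y
x+y≡z⇒x≡z-y {x} {y} refl = sym (//-rightDividesʳ +-0-group y x)

^*^≢0 : ∀ m n a b .{{_ : NonZero m}} .{{_ : NonZero n}} → NonZero (m ^ a * n ^ b)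
^*^≢0 m n a b = m*n≢0 (m ^ a) (n ^ b) {{m^n≢0 m a}} {{m^n≢0 n b}}

term≡rectTerm÷D : ∀ {k l a b} → a ≤ k → b ≤ l →
  term (suc k) (suc l) (suc a) (suc b) ≡
  (Lattice.rectTerm (suc k) (suc l) (suc k) (suc l) (suc a) (suc b) ÷ (suc k ^ k * suc l ^ l))
    {{^*^≢0 (suc k) (suc l) k l}}
term≡rectTerm÷D {a = a} {b} a≤k b≤l with m≤n⇒∃[o]m+o≡n a≤k | m≤n⇒∃[o]m+o≡n b≤l
... | i , refl | j , refl =
  ÷-≡ X Y (m ^ a * n ^ b) (m ^ (a + i) * n ^ (b + j))
      {{^*^≢0 m n a b}} {{^*^≢0 m n (a + i) (b + j)}} (begin
    X * (m ^ (a + i) * n ^ (b + j))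
      ≡⟨ cong₂ (λ c e → c * s ^ e * (m ^ (a + i) * n ^ (b + j))) binomial exponent ⟩
    pascal i j * s ^ (a + b) * (m ^ (a + i) * n ^ (b + j))
      ≡⟨ cong₂ (λ u v → pascal i j * u * v) (^-distribˡ-+-* s a b)
               (cong₂ _*_ (^-distribˡ-+-* m a i) (^-distribˡ-+-* n b j)) ⟩
    pascal i j * (s ^ a * s ^ b) * (m ^ a * m ^ i * (n ^ b * n ^ j))
      ≡⟨ rearrange (pascal i j) (s ^ a) (s ^ b) (m ^ a) (m ^ i) (n ^ b) (n ^ j) ⟩
    s ^ a * (s ^ b * w i j) * (m ^ a * n ^ b)
      ≡⟨ cong₂ (λ u v → s ^ a * (s ^ b * w u v) * (m ^ a * n ^ b)) (m+n∸m≡n a i) (m+n∸m≡n b j) ⟨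
    Y * (m ^ a * n ^ b) ∎)
  where
  open Lattice (suc (a + i)) (suc (b + j))
  m = suc (a + i)
  n = suc (b + j)
  X = ((s ∸ (suc a + suc b)) C (a + i ∸ a)) * s ^ (suc a + suc b ∸ 2)
  Y = s ^ a * (s ^ b * w (a + i ∸ a) (b + j ∸ b))
  binomial : (s ∸ (suc a + suc b)) C (a + i ∸ a) ≡ pascal i j
  binomial = begin
    (s ∸ (suc a + suc b)) C (a + i ∸ a)
      ≡⟨ cong₂ _C_ (cong (_∸ (suc a + suc b)) (shuffle a i b j)) (m+n∸m≡n a i) ⟩
    ((suc a + suc b) + (i + j) ∸ (suc a + suc b)) C i
      ≡⟨ cong (_C i) (m+n∸m≡n (suc a + suc b) (i + j)) ⟩
    (i + j) C i
      ≡⟨ pascal≡C i j ⟨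
    pascal i j ∎
    where
    shuffle : ∀ a i b j → suc (a + i) + suc (b + j) ≡ (suc a + suc b) + (i + j)
    shuffle = solve-∀
  exponent : suc a + suc b ∸ 2 ≡ a + b
  exponent = cong (_∸ 1) (+-suc a b)
  rearrange : ∀ P sa sb ma mi nb nj →
    P * (sa * sb) * (ma * mi * (nb * nj))
    ≡ sa * (sb * (P * (mi * nj))) * (ma * nb)
  rearrange = solve-∀

module _ (k l : ℕ) where
  private
    m n D : ℕ
    m = suc k
    n = suc l
    D = m ^ k * n ^ l
    instance
      D≢0 : NonZero D
      D≢0 = ^*^≢0 m n k l

  open Lattice m n

  lhs≡rect÷D : lhs m n ≡ rect m n ÷ D
  lhs≡rect÷D = begin
    lhs m n
      ≡⟨ sumFrom1-cong m (λ { a (s≤s a≤k) →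
           sumFrom1-cong n (λ { b (s≤s b≤l) → term≡rectTerm÷D a≤k b≤l }) }) ⟩
    sumFrom1 m (λ a → sumFrom1 n (λ b → rectTerm m n a b ÷ D))
      ≡⟨ sumFrom1-cong m (λ a _ → sumFrom1-÷ n (rectTerm m n (suc a)) D) ⟩
    sumFrom1 m (λ a → sumFrom1ℕ n (rectTerm m n a) ÷ D)
      ≡⟨ sumFrom1-÷ m (λ a → sumFrom1ℕ n (rectTerm m n a)) D ⟩
    sumFrom1ℕ m (λ a → sumFrom1ℕ n (rectTerm m n a)) ÷ D
      ≡⟨ cong (_÷ D) (rect≡sumFrom1ℕ² m n) ⟨
    rect m n ÷ D ∎

  rect+n*pascal*D≡power : rect m n + n * pascal k n * D ≡ s ^ (k + n)
  rect+n*pascal*D≡power = begin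
    rect m n + n * pascal k n * D
      ≡⟨ cong₂ _+_ (rect-suc k n) (*-assoc n (pascal k n) D) ⟩
    (m * col k n + n * row n k) + n * (pascal k n * D)
      ≡⟨ +-assoc (m * col k n) _ _ ⟩
    m * col k n + (n * row n k + n * (pascal k n * D))
      ≡⟨ cong (λ t → m * col k n + t) (*-distribˡ-+ n (row n k) _) ⟨
    m * col k n + n * (row n k + pascal k n * D)
      ≡⟨ cong (λ r → m * col k n + n * r) (row-shift l k) ⟨
    m * col k n + n * row l m
      ≡⟨ first-exit-decomposition k l ⟩
    s ^ suc (k + l)
      ≡⟨ cong (s ^_) (+-suc k l) ⟨
    s ^ (k + n) ∎

  m*n/[m+n]*C≡n*pascal : ((m * n) ÷ (m + n)) ℚ.* (((m + n) C m) ÷ 1) ≡ (n * pascal k n) ÷ 1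
  m*n/[m+n]*C≡n*pascal = trans (÷-*-÷ (m * n) ((m + n) C m) (m + n) 1)
    (÷-≡ (m * n * ((m + n) C m)) (n * pascal k n) ((m + n) * 1) 1 {{m*n≢0 (m + n) 1}} (begin
      m * n * ((m + n) C m) * 1      ≡⟨ cong (λ c → m * n * c * 1) (pascal≡C m n) ⟨
      m * n * pascal m n * 1         ≡⟨ rearrange m n (pascal m n) ⟩
      n * (m * pascal m n)           ≡⟨ cong (n *_) (pascal-absorbˡ k n) ⟩
      n * ((m + n) * pascal k n)     ≡⟨ rearrange′ n (m + n) (pascal k n) ⟩
      n * pascal k n * ((m + n) * 1) ∎))
    where
    rearrange : ∀ m n P → m * n * P * 1 ≡ n * (m * P)
    rearrange = solve-∀
    rearrange′ : ∀ n N P → n * (N * P) ≡ n * P * (N * 1)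
    rearrange′ = solve-∀

  rect÷D≡rhs : rect m n ÷ D ≡ rhs m n
  rect÷D≡rhs = begin
    rect m n ÷ D
      ≡⟨ x+y≡z⇒x≡z-y rect÷D+n*pascal≡power÷D ⟩
    s ^ (k + n) ÷ D ℚ.- (n * pascal k n) ÷ 1
      ≡⟨ cong (λ c → s ^ (k + n) ÷ D ℚ.- c) m*n/[m+n]*C≡n*pascal ⟨
    rhs m n ∎
    where
    rect÷D+n*pascal≡power÷D : rect m n ÷ D ℚ.+ (n * pascal k n) ÷ 1 ≡ s ^ (k + n) ÷ D
    rect÷D+n*pascal≡power÷D = trans (÷-+-÷ (rect m n) (n * pascal k n) D 1)
      (÷-≡ (rect m n * 1 + n * pascal k n * D) (s ^ (k + n)) (D * 1) D {{m*n≢0 D 1}} (begin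
        (rect m n * 1 + n * pascal k n * D) * D ≡⟨ cong (λ r → (r + n * pascal k n * D) * D)
                                                        (*-identityʳ (rect m n)) ⟩
        (rect m n + n * pascal k n * D) * D     ≡⟨ cong (_* D) rect+n*pascal*D≡power ⟩
        s ^ (k + n) * D                         ≡⟨ cong (s ^ (k + n) *_) (*-identityʳ D) ⟨
        s ^ (k + n) * (D * 1)                   ∎))

mainTheorem5 : (m n : ℕ) → .{{_ : NonZero m}} → .{{_ : NonZero n}} →
    lhs m n ≡ rhs m n
mainTheorem5 (suc k) (suc l) = trans (lhs≡rect÷D k l) (rect÷D≡rhs k l)
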